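{- Every tight affine vector space partition of length $n\ge 1$ has size at least $n+1$.
   Context: Identify $\{0,1\}^n$ with $\mathbb{F}_2^n$. An affine vector space partition of length $n$ is a partition of $\mathbb{F}_2^n$ into affine subspaces $x+V$ ($V$ a linear subspace, called the linear part); its size is the number of affine subspaces. It is tight if the intersection of the linear parts of all its affine subspaces is $\{0^n\}$. -}

module Defs where

open import Data.Bool using (Bool; false; _xor_)
open import Data.Nat using (ℕ)
open import Data.Fin using (Fin)
open import Data.Vec using (Vec; replicate; zipWith)
open import Data.Product using (Σ; _×_)
open import Relation.Binary.PropositionalEquality using (_≡_)

𝔽₂^ : ℕ → Set
𝔽₂^ n = Vec Bool n

0ᵛ : ∀ {n} → 𝔽₂^ n
0ᵛ = replicate _ false

_⊕_ : ∀ {n} → 𝔽₂^ n → 𝔽₂^ n → 𝔽₂^ n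
_⊕_ = zipWith _xor_

-- A linear subspace of F₂ⁿ: a subset containing 0 and closed under addition
-- (scalar multiplication over F₂ is then automatic).
record Subspace (n : ℕ) : Set₁ where
  field
    _∈V       : 𝔽₂^ n → Set
    zero-∈    : 0ᵛ ∈V
    ⊕-closed  : ∀ u v → u ∈V → v ∈V → (u ⊕ v) ∈V
open Subspace public

record AffineSubspace (n : ℕ) : Set₁ where
  field
    point      : 𝔽₂^ n
    linearPart : Subspace n
open AffineSubspace public

_∈A_ : ∀ {n} → 𝔽₂^ n → AffineSubspace n → Set
y ∈A A = _∈V (linearPart A) (y ⊕ point A)

IsAVSP : ∀ {n k} → (Fin k → AffineSubspace n) → Set
IsAVSP {n} {k} A =
  (∀ (y : 𝔽₂^ n) → Σ (Fin k) (λ i → y ∈A A i)) ×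
  (∀ (y : 𝔽₂^ n) (i j : Fin k) → y ∈A A i → y ∈A A j → i ≡ j)

IsTight : ∀ {n k} → (Fin k → AffineSubspace n) → Set
IsTight {n} {k} A =
  ∀ (v : 𝔽₂^ n) → (∀ (i : Fin k) → _∈V (linearPart (A i)) v) → v ≡ 0ᵛ

-- Colour each point of 𝔽₂ⁿ by the index of its part. Colour classes are closed under
-- x + y + z, and tightness says that no nonzero w is a period (colour(y + w) = colour(y) for
-- all y). Induct on n: if some affine hyperplane H misses a whole colour class, the colouring
-- restricted to H ≅ 𝔽₂ⁿ⁻¹ uses at most k − 1 colours, so k − 1 ≥ n provided the restriction is
-- still aperiodic. Otherwise a nonzero period w of the restriction fails globally at some y, and
-- the hyperplane missing the class of y and separating y from y + w sees strictly more colours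
-- than H. Colours being finite, this search ends at a hyperplane with aperiodic restriction.

module Submission where

open import Defs
open import Data.Nat using (ℕ; zero; suc; _≤_; _<_; z≤n; s≤s)
open import Data.Fin using (Fin; punchOut) renaming (_≟_ to _≟ᶠ_)
open import Data.Fin.Properties using (punchOut-cong; punchOut-injective)
open import Data.Fin.Subset using (Subset; _∈_; _⊂_)
open import Data.Fin.Subset.Induction using (⊂-wellFounded)
open import Data.Bool using (Bool; true; false; not; _∧_; _xor_)
open import Data.Bool.Properties
  using (xor-assoc; xor-comm; xor-same; xor-identityʳ; xor-annihilates-not; not-distribʳ-xor; not-involutive;
         ∧-distribˡ-xor; ∧-zeroʳ; ∧-identityʳ; not-¬; ¬-not; xor-∧-commutativeRing)
  renaming (_≟_ to _≟ᵇ_)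
open import Data.Vec using ([]; _∷_; tabulate)
open import Data.Vec.Properties
  using (zipWith-assoc; zipWith-comm; zipWith-identityˡ; zipWith-identityʳ;
         lookup∘tabulate; []=⇒lookup; lookup⇒[]=)
  renaming (≡-dec to ≡-decᵛ)
open import Data.Product using (∃; _×_; _,_; proj₁; proj₂)
open import Data.Sum using (_⊎_; inj₁; inj₂)
open import Function using (_∘_)
open import Level using (0ℓ)
open import Algebra.Bundles using (CommutativeSemigroup; CommutativeRing)
import Algebra.Properties.CommutativeSemigroup as CommutativeSemigroupProperties
open import Induction.WellFounded using (Acc; acc)
open import Relation.Nullary using (Dec; yes; no; ¬_; contradiction; does)
open import Relation.Nullary.Decidable using (map′; ¬?; _×-dec_; _⊎-dec_; _→-dec_; decidable-stable; dec-true)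
open import Relation.Unary using (Pred; Decidable)
open import Relation.Binary.PropositionalEquality

private
  variable
    m n k : ℕ

⊕-assoc : (x y z : 𝔽₂^ n) → (x ⊕ y) ⊕ z ≡ x ⊕ (y ⊕ z)
⊕-assoc = zipWith-assoc xor-assoc

⊕-comm : (x y : 𝔽₂^ n) → x ⊕ y ≡ y ⊕ x
⊕-comm = zipWith-comm xor-comm

⊕-identityˡ : (x : 𝔽₂^ n) → 0ᵛ ⊕ x ≡ x
⊕-identityˡ = zipWith-identityˡ λ _ → refl

⊕-identityʳ : (x : 𝔽₂^ n) → x ⊕ 0ᵛ ≡ x
⊕-identityʳ = zipWith-identityʳ xor-identityʳ

⊕-self : (x : 𝔽₂^ n) → x ⊕ x ≡ 0ᵛ
⊕-self []      = refl
⊕-self (b ∷ x) = cong₂ _∷_ (xor-same b) (⊕-self x)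

⊕-cancelˡ : (x y : 𝔽₂^ n) → x ⊕ (x ⊕ y) ≡ y
⊕-cancelˡ x y = begin
  x ⊕ (x ⊕ y)  ≡⟨ ⊕-assoc x x y ⟨
  (x ⊕ x) ⊕ y  ≡⟨ cong (_⊕ y) (⊕-self x) ⟩
  0ᵛ ⊕ y       ≡⟨ ⊕-identityˡ y ⟩
  y            ∎
  where open ≡-Reasoning

⊕-cancelʳ : (x y : 𝔽₂^ n) → (x ⊕ y) ⊕ x ≡ y
⊕-cancelʳ x y = trans (⊕-comm (x ⊕ y) x) (⊕-cancelˡ x y)

⊕≡0⇒≡ : (x y : 𝔽₂^ n) → x ⊕ y ≡ 0ᵛ → y ≡ x
⊕≡0⇒≡ x y x⊕y≡0 = begin
  y            ≡⟨ ⊕-cancelˡ x y ⟨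
  x ⊕ (x ⊕ y)  ≡⟨ cong (x ⊕_) x⊕y≡0 ⟩
  x ⊕ 0ᵛ       ≡⟨ ⊕-identityʳ x ⟩
  x            ∎
  where open ≡-Reasoning

⊕-commutativeSemigroup : ℕ → CommutativeSemigroup _ _
⊕-commutativeSemigroup n = record
  { Carrier                 = 𝔽₂^ n
  ; _≈_                     = _≡_
  ; _∙_                     = _⊕_
  ; isCommutativeSemigroup  = record
    { isSemigroup = record
      { isMagma = record { isEquivalence = isEquivalence ; ∙-cong = cong₂ _⊕_ }
      ; assoc   = ⊕-assoc
      }
    ; comm = ⊕-comm
    }
  }

module ⊕-Properties {n : ℕ} = CommutativeSemigroupProperties (⊕-commutativeSemigroup n)
module xor-Properties =
  CommutativeSemigroupProperties (CommutativeRing.+-commutativeSemigroup xor-∧-commutativeRing)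

xor-cancelʳ : ∀ a b → (a xor b) xor b ≡ a
xor-cancelʳ a b = trans (xor-assoc a b b) (trans (cong (a xor_) (xor-same b)) (xor-identityʳ a))

xor-affine₃ : ∀ s x y z → s xor ((x xor y) xor z) ≡ ((s xor x) xor (s xor y)) xor (s xor z)
xor-affine₃ false x y z = refl
xor-affine₃ true  x y z = begin
  not ((x xor y) xor z)            ≡⟨ not-distribʳ-xor (x xor y) z ⟩
  (x xor y) xor not z              ≡⟨ cong (_xor not z) (xor-annihilates-not x y) ⟨
  ((not x) xor (not y)) xor not z  ∎
  where open ≡-Reasoning

xor≡false⇒≡ : ∀ x y → x xor y ≡ false → y ≡ x
xor≡false⇒≡ false false _ = refl
xor≡false⇒≡ true  true  _ = refl

infix 8 _·_
_·_ : 𝔽₂^ n → 𝔽₂^ n → Bool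
[]      · []      = false
(a ∷ g) · (b ∷ y) = (a ∧ b) xor (g · y)

·-zeroˡ : (y : 𝔽₂^ n) → 0ᵛ · y ≡ false
·-zeroˡ []      = refl
·-zeroˡ (_ ∷ y) = ·-zeroˡ y

·-distribˡ-⊕ : (g u v : 𝔽₂^ n) → g · (u ⊕ v) ≡ (g · u) xor (g · v)
·-distribˡ-⊕ []      []      []      = refl
·-distribˡ-⊕ (a ∷ g) (b ∷ u) (c ∷ v) = begin
  (a ∧ (b xor c)) xor (g · (u ⊕ v))
    ≡⟨ cong₂ _xor_ (∧-distribˡ-xor a b c) (·-distribˡ-⊕ g u v) ⟩
  ((a ∧ b) xor (a ∧ c)) xor ((g · u) xor (g · v))
    ≡⟨ xor-Properties.interchange (a ∧ b) (a ∧ c) (g · u) (g · v) ⟩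
  ((a ∧ b) xor (g · u)) xor ((a ∧ c) xor (g · v))
    ∎
  where open ≡-Reasoning

-- Partitions as colourings

infix 4 _∈ˢ_
_∈ˢ_ : 𝔽₂^ n → Subspace n → Set
v ∈ˢ V = _∈V V v

point-∈A : (A : AffineSubspace n) → point A ∈A A
point-∈A A = subst (_∈ˢ linearPart A) (sym (⊕-self (point A))) (zero-∈ (linearPart A))

∈A⇒∈linearPart : (A : AffineSubspace n) {w : 𝔽₂^ n} → (point A ⊕ w) ∈A A → w ∈ˢ linearPart A
∈A⇒∈linearPart A {w} = subst (_∈ˢ linearPart A) (⊕-cancelʳ (point A) w)

∈A-⊕₃ : (A : AffineSubspace n) {a b c : 𝔽₂^ n} → a ∈A A → b ∈A A → c ∈A A → ((a ⊕ b) ⊕ c) ∈A A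
∈A-⊕₃ {n} A {a} {b} {c} a∈A b∈A c∈A =
  subst (_∈ˢ V) translate (⊕-closed V _ _ (⊕-closed V _ _ a∈A b∈A) c∈A)
  where
  V : Subspace n
  V = linearPart A
  x : 𝔽₂^ n
  x = point A
  open ≡-Reasoning
  translate : ((a ⊕ x) ⊕ (b ⊕ x)) ⊕ (c ⊕ x) ≡ ((a ⊕ b) ⊕ c) ⊕ x
  translate = begin
    ((a ⊕ x) ⊕ (b ⊕ x)) ⊕ (c ⊕ x)  ≡⟨ cong (_⊕ (c ⊕ x)) (⊕-Properties.interchange a x b x) ⟩
    ((a ⊕ b) ⊕ (x ⊕ x)) ⊕ (c ⊕ x)  ≡⟨ cong (λ z → ((a ⊕ b) ⊕ z) ⊕ (c ⊕ x)) (⊕-self x) ⟩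
    ((a ⊕ b) ⊕ 0ᵛ) ⊕ (c ⊕ x)       ≡⟨ cong (_⊕ (c ⊕ x)) (⊕-identityʳ (a ⊕ b)) ⟩
    (a ⊕ b) ⊕ (c ⊕ x)              ≡⟨ ⊕-assoc (a ⊕ b) c x ⟨
    ((a ⊕ b) ⊕ c) ⊕ x              ∎

Colouring : ℕ → ℕ → Set
Colouring n k = 𝔽₂^ n → Fin k

IsAffineColouring : Colouring n k → Set
IsAffineColouring q = ∀ a b c → q b ≡ q a → q c ≡ q a → q ((a ⊕ b) ⊕ c) ≡ q a

IsPeriod : Colouring n k → 𝔽₂^ n → Set
IsPeriod q w = ∀ y → q (y ⊕ w) ≡ q y

IsAperiodic : Colouring n k → Set
IsAperiodic q = ∀ w → IsPeriod q w → w ≡ 0ᵛ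

module PartitionColouring {A : Fin k → AffineSubspace n} (avsp : IsAVSP A) where

  part : Colouring n k
  part y = proj₁ (proj₁ avsp y)

  ∈-part : ∀ y → y ∈A A (part y)
  ∈-part y = proj₂ (proj₁ avsp y)

  part-unique : ∀ {y i} → y ∈A A i → part y ≡ i
  part-unique {y} {i} = proj₂ avsp y (part y) i (∈-part y)

  ∈-part-of : ∀ {y z} → part z ≡ part y → z ∈A A (part y)
  ∈-part-of {z = z} eq = subst (λ i → z ∈A A i) eq (∈-part z)

  part-affine : IsAffineColouring part
  part-affine a b c qb qc =
    part-unique (∈A-⊕₃ (A (part a)) (∈-part a) (∈-part-of qb) (∈-part-of qc))

  part-aperiodic : IsTight A → IsAperiodic part
  part-aperiodic tight w period = tight w λ i →
    let x = point (A i)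
        partx≡i = part-unique (point-∈A (A i))
    in ∈A⇒∈linearPart (A i) (subst (λ j → (x ⊕ w) ∈A A j) (trans (period x) partx≡i) (∈-part (x ⊕ w)))

classSubspace : {q : Colouring n k} → IsAffineColouring q → 𝔽₂^ n → Subspace n
classSubspace {q = q} affine y = record
  { _∈V      = λ v → q (y ⊕ v) ≡ q y
  ; zero-∈   = cong q (⊕-identityʳ y)
  ; ⊕-closed = λ u v qu qv →
      subst (λ z → q z ≡ q y) (shift u v) (affine y (y ⊕ u) (y ⊕ v) qu qv)
  }
  where
  shift : ∀ u v → (y ⊕ (y ⊕ u)) ⊕ (y ⊕ v) ≡ y ⊕ (u ⊕ v)
  shift u v = trans (cong (_⊕ (y ⊕ v)) (⊕-cancelˡ y u)) (⊕-Properties.x∙yz≈y∙xz u y v)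

∃? : {P : Pred (𝔽₂^ n) 0ℓ} → Decidable P → Dec (∃ P)
∃? {zero}  P? = map′ ([] ,_) (λ { ([] , p) → p }) (P? [])
∃? {suc n} {P} P? = map′ from to (∃? (P? ∘ (true ∷_)) ⊎-dec ∃? (P? ∘ (false ∷_)))
  where
  from : ∃ (P ∘ (true ∷_)) ⊎ ∃ (P ∘ (false ∷_)) → ∃ P
  from (inj₁ (y , p)) = true ∷ y , p
  from (inj₂ (y , p)) = false ∷ y , p
  to : ∃ P → ∃ (P ∘ (true ∷_)) ⊎ ∃ (P ∘ (false ∷_))
  to (true  ∷ y , p) = inj₁ (y , p)
  to (false ∷ y , p) = inj₂ (y , p)

∀⊎∃¬ : {P : Pred (𝔽₂^ n) 0ℓ} → Decidable P → (∀ y → P y) ⊎ ∃ (¬_ ∘ P)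
∀⊎∃¬ P? with ∃? (¬? ∘ P?)
... | yes counterexample = inj₂ counterexample
... | no  none           = inj₁ λ y → decidable-stable (P? y) (λ ¬py → none (y , ¬py))

∀? : {P : Pred (𝔽₂^ n) 0ℓ} → Decidable P → Dec (∀ y → P y)
∀? P? with ∀⊎∃¬ P?
... | inj₁ all           = yes all
... | inj₂ (y , ¬py)     = no λ all → ¬py (all y)

isPeriod? : (q : Colouring n k) → Decidable (IsPeriod q)
isPeriod? q w = ∀? λ y → q (y ⊕ w) ≟ᶠ q y

nonPeriod⇒witness : (q : Colouring n k) {w : 𝔽₂^ n} → ¬ IsPeriod q w → ∃ λ y → q (y ⊕ w) ≢ q y
nonPeriod⇒witness q ¬period with ∀⊎∃¬ (λ y → q (y ⊕ _) ≟ᶠ q y)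
... | inj₁ period  = contradiction period ¬period
... | inj₂ witness = witness

aperiodic⊎period : (q : Colouring n k) → IsAperiodic q ⊎ ∃ λ w → w ≢ 0ᵛ × IsPeriod q w
aperiodic⊎period q with ∀⊎∃¬ (λ w → isPeriod? q w →-dec ≡-decᵛ _≟ᵇ_ w 0ᵛ)
... | inj₁ aperiodic    = inj₁ aperiodic
... | inj₂ (w , ¬trivial) with isPeriod? q w
...   | yes period = inj₂ (w , (λ w≡0 → ¬trivial λ _ → w≡0) , period)
...   | no ¬period = contradiction (λ period → contradiction period ¬period) ¬trivial

-- Separating a vector from a subspace by a linear functional

tailSubspace : Subspace (suc n) → Subspace n
tailSubspace V = record
  { _∈V      = λ v → (false ∷ v) ∈ˢ V
  ; zero-∈   = zero-∈ V
  ; ⊕-closed = λ u v → ⊕-closed V (false ∷ u) (false ∷ v)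
  }

Separates : 𝔽₂^ n → Subspace n → 𝔽₂^ n → Set
Separates g V w = (∀ v → v ∈ˢ V → g · v ≡ false) × g · w ≡ true

separate : (V : Subspace n) → Decidable (_∈ˢ V) → ∀ {w} → ¬ w ∈ˢ V → ∃ λ g → Separates g V w
separate {zero}  V V? {[]} w∉V = contradiction (zero-∈ V) w∉V
separate {suc n} V V? {w}  w∉V with ∃? (V? ∘ (true ∷_))
... | yes (u , u∈V) = (g · u) ∷ g , g⊥V , g·w
  where
  -- Adding the pivot true ∷ u clears the first coordinate without leaving V.
  reduce : 𝔽₂^ (suc n) → 𝔽₂^ n
  reduce (false ∷ v) = v
  reduce (true  ∷ v) = u ⊕ v

  reduce-∈ : ∀ v → v ∈ˢ V → reduce v ∈ˢ tailSubspace V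
  reduce-∈ (false ∷ v) v∈V = v∈V
  reduce-∈ (true  ∷ v) v∈V = ⊕-closed V (true ∷ u) (true ∷ v) u∈V v∈V

  reduce-∉ : ∀ v → ¬ v ∈ˢ V → ¬ reduce v ∈ˢ tailSubspace V
  reduce-∉ (false ∷ v) v∉V = v∉V
  reduce-∉ (true  ∷ v) v∉V r∈V =
    v∉V (subst (λ z → (true ∷ z) ∈ˢ V) (⊕-cancelˡ u v) (⊕-closed V (true ∷ u) (false ∷ (u ⊕ v)) u∈V r∈V))

  separated : ∃ λ g → Separates g (tailSubspace V) (reduce w)
  separated = separate (tailSubspace V) (V? ∘ (false ∷_)) (reduce-∉ w w∉V)
  g : 𝔽₂^ n
  g = proj₁ separated

  ·-reduce : ∀ v → ((g · u) ∷ g) · v ≡ g · reduce v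
  ·-reduce (false ∷ v) = cong (_xor (g · v)) (∧-zeroʳ (g · u))
  ·-reduce (true  ∷ v) = trans (cong (_xor (g · v)) (∧-identityʳ (g · u))) (sym (·-distribˡ-⊕ g u v))

  g⊥V : ∀ v → v ∈ˢ V → ((g · u) ∷ g) · v ≡ false
  g⊥V v v∈V = trans (·-reduce v) (proj₁ (proj₂ separated) (reduce v) (reduce-∈ v v∈V))

  g·w : ((g · u) ∷ g) · w ≡ true
  g·w = trans (·-reduce w) (proj₂ (proj₂ separated))
... | no no-pivot with w
...   | true ∷ w′ = true ∷ 0ᵛ , e₀⊥V , cong (true xor_) (·-zeroˡ w′)
  where
  e₀⊥V : ∀ v → v ∈ˢ V → (true ∷ 0ᵛ) · v ≡ false
  e₀⊥V (false ∷ v) _   = ·-zeroˡ v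
  e₀⊥V (true  ∷ v) v∈V = contradiction (v , v∈V) no-pivot
...   | false ∷ w′ = false ∷ g , g⊥V , proj₂ (proj₂ separated)
  where
  separated : ∃ λ g → Separates g (tailSubspace V) w′
  separated = separate (tailSubspace V) (V? ∘ (false ∷_)) w∉V
  g : 𝔽₂^ n
  g = proj₁ separated
  g⊥V : ∀ v → v ∈ˢ V → (false ∷ g) · v ≡ false
  g⊥V (false ∷ v) v∈V = proj₁ (proj₂ separated) v v∈V
  g⊥V (true  ∷ v) v∈V = contradiction (v , v∈V) no-pivot

-- Affine hyperplanes {y | g · y ≡ s}, parametrised by 𝔽₂ⁿ⁻¹

data Nonzero : 𝔽₂^ n → Set where
  here  : {g : 𝔽₂^ n} → Nonzero (true ∷ g)
  there : {g : 𝔽₂^ n} → Nonzero g → Nonzero (false ∷ g)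

·≡true⇒nonzero : (g y : 𝔽₂^ n) → g · y ≡ true → Nonzero g
·≡true⇒nonzero []          []      ()
·≡true⇒nonzero (true  ∷ g) (_ ∷ y) _     = here
·≡true⇒nonzero (false ∷ g) (_ ∷ y) g·y≡1 = there (·≡true⇒nonzero g y g·y≡1)

-- The first nonzero coordinate of g is solved for; the others are free.
embed : (g : 𝔽₂^ (suc m)) → Nonzero g → Bool → 𝔽₂^ m → 𝔽₂^ (suc m)
embed (true ∷ g)          here       s z        = (s xor (g · z)) ∷ z
embed {suc m} (false ∷ g) (there nz) s (z ∷ zs) = z ∷ embed g nz s zs

project : (g : 𝔽₂^ (suc m)) → Nonzero g → 𝔽₂^ (suc m) → 𝔽₂^ m
project (true ∷ g)          here       (_ ∷ y) = y
project {suc m} (false ∷ g) (there nz) (y ∷ ys) = y ∷ project g nz ys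

embed-on : (g : 𝔽₂^ (suc m)) (nz : Nonzero g) (s : Bool) (z : 𝔽₂^ m) → g · embed g nz s z ≡ s
embed-on (true ∷ g)          here       s z        = xor-cancelʳ s (g · z)
embed-on {suc m} (false ∷ g) (there nz) s (_ ∷ zs) = embed-on g nz s zs

embed-project : (g : 𝔽₂^ (suc m)) (nz : Nonzero g) {s : Bool} (y : 𝔽₂^ (suc m)) →
                g · y ≡ s → embed g nz s (project g nz y) ≡ y
embed-project (true ∷ g)          here       (b ∷ y)  refl = cong (_∷ y) (xor-cancelʳ b (g · y))
embed-project {suc m} (false ∷ g) (there nz) (b ∷ ys) g·y≡s = cong (b ∷_) (embed-project g nz ys g·y≡s)

project-embed : (g : 𝔽₂^ (suc m)) (nz : Nonzero g) (s : Bool) (z : 𝔽₂^ m) → project g nz (embed g nz s z) ≡ z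
project-embed (true ∷ g)          here       s z        = refl
project-embed {suc m} (false ∷ g) (there nz) s (z ∷ zs) = cong (z ∷_) (project-embed g nz s zs)

embed-⊕₃ : (g : 𝔽₂^ (suc m)) (nz : Nonzero g) (s : Bool) (a b c : 𝔽₂^ m) →
           embed g nz s ((a ⊕ b) ⊕ c) ≡ (embed g nz s a ⊕ embed g nz s b) ⊕ embed g nz s c
embed-⊕₃ (true ∷ g)          here       s a b c = cong (_∷ ((a ⊕ b) ⊕ c)) (begin
  s xor (g · ((a ⊕ b) ⊕ c))
    ≡⟨ cong (s xor_) (trans (·-distribˡ-⊕ g (a ⊕ b) c) (cong (_xor (g · c)) (·-distribˡ-⊕ g a b))) ⟩
  s xor (((g · a) xor (g · b)) xor (g · c))
    ≡⟨ xor-affine₃ s (g · a) (g · b) (g · c) ⟩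
  ((s xor (g · a)) xor (s xor (g · b))) xor (s xor (g · c))
    ∎)
  where open ≡-Reasoning
embed-⊕₃ {suc m} (false ∷ g) (there nz) s (a ∷ as) (b ∷ bs) (c ∷ cs) =
  cong (((a xor b) xor c) ∷_) (embed-⊕₃ g nz s as bs cs)

fromDec : {P : Pred (Fin n) 0ℓ} → Decidable P → Subset n
fromDec P? = tabulate (does ∘ P?)

∈-fromDec⁺ : {P : Pred (Fin n) 0ℓ} (P? : Decidable P) {i : Fin n} → P i → i ∈ fromDec P?
∈-fromDec⁺ P? {i} p = lookup⇒[]= i _ (trans (lookup∘tabulate (does ∘ P?) i) (dec-true (P? i) p))

∈-fromDec⁻ : {P : Pred (Fin n) 0ℓ} (P? : Decidable P) {i : Fin n} → i ∈ fromDec P? → P i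
∈-fromDec⁻ P? {i} i∈ with P? i | trans (sym (lookup∘tabulate (does ∘ P?) i)) ([]=⇒lookup i∈)
... | yes p | _  = p
... | no _  | ()

module HyperplaneDescent
  (q : Colouring (suc m) (suc k)) (affine : IsAffineColouring q) (aperiodic : IsAperiodic q)
  (restriction-bound : (q′ : Colouring m k) → IsAffineColouring q′ → IsAperiodic q′ → m < k)
  where

  record Hyperplane : Set where
    field
      normal  : 𝔽₂^ (suc m)
      nonzero : Nonzero normal
      side    : Bool
      missed  : Fin (suc k)
      misses  : ∀ y → normal · y ≡ side → missed ≢ q y

  open Hyperplane

  infix 4 _∈H_
  _∈H_ : 𝔽₂^ (suc m) → Hyperplane → Set
  y ∈H H = normal H · y ≡ side H

  embedH : Hyperplane → 𝔽₂^ m → 𝔽₂^ (suc m)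
  embedH H = embed (normal H) (nonzero H) (side H)

  projectH : Hyperplane → 𝔽₂^ (suc m) → 𝔽₂^ m
  projectH H = project (normal H) (nonzero H)

  embedH-misses : ∀ H z → missed H ≢ q (embedH H z)
  embedH-misses H z = misses H (embedH H z) (embed-on (normal H) (nonzero H) (side H) z)

  restrict : Hyperplane → Colouring m k
  restrict H z = punchOut (embedH-misses H z)

  restrict-reflects : ∀ H {a b} → restrict H b ≡ restrict H a → q (embedH H b) ≡ q (embedH H a)
  restrict-reflects H {a} {b} = punchOut-injective (embedH-misses H b) (embedH-misses H a)

  restrict-affine : ∀ H → IsAffineColouring (restrict H)
  restrict-affine H a b c qb qc = punchOut-cong (missed H) (begin
    q (e ((a ⊕ b) ⊕ c))        ≡⟨ cong q (embed-⊕₃ (normal H) (nonzero H) (side H) a b c) ⟩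
    q ((e a ⊕ e b) ⊕ e c)      ≡⟨ affine (e a) (e b) (e c) (restrict-reflects H qb) (restrict-reflects H qc) ⟩
    q (e a)                    ∎)
    where
    e : 𝔽₂^ m → 𝔽₂^ (suc m)
    e = embedH H
    open ≡-Reasoning

  direction : Hyperplane → 𝔽₂^ m → 𝔽₂^ (suc m)
  direction H w = embedH H 0ᵛ ⊕ embedH H w

  direction-nonzero : ∀ H {w} → w ≢ 0ᵛ → direction H w ≢ 0ᵛ
  direction-nonzero H {w} w≢0 d≡0 = w≢0 (begin
    w                       ≡⟨ project-embed (normal H) (nonzero H) (side H) w ⟨
    projectH H (embedH H w)  ≡⟨ cong (projectH H) (⊕≡0⇒≡ _ _ d≡0) ⟩
    projectH H (embedH H 0ᵛ) ≡⟨ project-embed (normal H) (nonzero H) (side H) 0ᵛ ⟩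
    0ᵛ                      ∎)
    where open ≡-Reasoning

  IsPeriodOn : Hyperplane → 𝔽₂^ (suc m) → Set
  IsPeriodOn H w = ∀ y → y ∈H H → q (y ⊕ w) ≡ q y

  restrict-period : ∀ H {w} → IsPeriod (restrict H) w → IsPeriodOn H (direction H w)
  restrict-period H {w} period y y∈H =
    subst (λ y → q (y ⊕ direction H w) ≡ q y) (embed-project (normal H) (nonzero H) y y∈H) (begin
      q (e z ⊕ (e 0ᵛ ⊕ e w))   ≡⟨ cong q (⊕-assoc (e z) (e 0ᵛ) (e w)) ⟨
      q ((e z ⊕ e 0ᵛ) ⊕ e w)   ≡⟨ cong q (embed-⊕₃ (normal H) (nonzero H) (side H) z 0ᵛ w) ⟨
      q (e ((z ⊕ 0ᵛ) ⊕ w))     ≡⟨ cong (λ x → q (e (x ⊕ w))) (⊕-identityʳ z) ⟩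
      q (e (z ⊕ w))           ≡⟨ restrict-reflects H (period z) ⟩
      q (e z)                 ∎)
    where
    e : 𝔽₂^ m → 𝔽₂^ (suc m)
    e = embedH H
    z : 𝔽₂^ m
    z = projectH H y
    open ≡-Reasoning

  Sees : Hyperplane → Fin (suc k) → Set
  Sees H i = ∃ λ y → y ∈H H × q y ≡ i

  sees? : ∀ H → Decidable (Sees H)
  sees? H i = ∃? λ y → (normal H · y ≟ᵇ side H) ×-dec (q y ≟ᶠ i)

  unseen : Hyperplane → Subset (suc k)
  unseen H = fromDec (¬? ∘ sees? H)

  ∈-unseen⁺ : ∀ H {i} → ¬ Sees H i → i ∈ unseen H
  ∈-unseen⁺ H = ∈-fromDec⁺ (¬? ∘ sees? H)

  ∈-unseen⁻ : ∀ H {i} → i ∈ unseen H → ¬ Sees H i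
  ∈-unseen⁻ H = ∈-fromDec⁻ (¬? ∘ sees? H)

  separator : ∀ y {w} → q (y ⊕ w) ≢ q y → ∃ λ g → Separates g (classSubspace affine y) w
  separator y = separate (classSubspace affine y) (λ v → q (y ⊕ v) ≟ᶠ q y)

  -- The separator is constant on the colour class of y, so its other side misses q y.
  through : ∀ y {w} → q (y ⊕ w) ≢ q y → Hyperplane
  through y {w} ny = record
    { normal  = g
    ; nonzero = ·≡true⇒nonzero g w (proj₂ (proj₂ (separator y ny)))
    ; side    = not (g · y)
    ; missed  = q y
    ; misses  = λ z g·z qy≡qz → not-¬ (constant z (sym qy≡qz)) g·z
    }
    where
    g : 𝔽₂^ (suc m)
    g = proj₁ (separator y ny)
    constant : ∀ z → q z ≡ q y → g · z ≡ g · y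
    constant z qz≡qy = xor≡false⇒≡ (g · y) (g · z) (trans (sym (·-distribˡ-⊕ g y z))
      (proj₁ (proj₂ (separator y ny)) (y ⊕ z) (trans (cong q (⊕-cancelˡ y z)) qz≡qy)))

  through-flip : ∀ y {w} (ny : q (y ⊕ w) ≢ q y) z →
                 normal (through y ny) · (z ⊕ w) ≡ not (normal (through y ny) · z)
  through-flip y {w} ny z = begin
    g · (z ⊕ w)        ≡⟨ ·-distribˡ-⊕ g z w ⟩
    (g · z) xor (g · w) ≡⟨ cong ((g · z) xor_) (proj₂ (proj₂ (separator y ny))) ⟩
    (g · z) xor true    ≡⟨ xor-comm (g · z) true ⟩
    not (g · z)         ∎
    where
    g : 𝔽₂^ (suc m)
    g = proj₁ (separator y ny)
    open ≡-Reasoning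

  through⊎shifted : ∀ y {w} (ny : q (y ⊕ w) ≢ q y) z → z ∈H through y ny ⊎ z ⊕ w ∈H through y ny
  through⊎shifted y ny z with normal (through y ny) · z ≟ᵇ not (normal (through y ny) · y)
  ... | yes z∈H = inj₁ z∈H
  ... | no  z∉H = inj₂ (trans (through-flip y ny z) (cong not (trans (¬-not z∉H) (not-involutive _))))

  -- w is not a global period, so it fails at some y. The hyperplane through y separating
  -- y from y ⊕ w sees every colour H sees (one of z, z ⊕ w lies on it) and also q (y ⊕ w),
  -- which H cannot see.
  improve : (H : Hyperplane) {w : 𝔽₂^ (suc m)} → w ≢ 0ᵛ → IsPeriodOn H w → ∃ λ H′ → unseen H′ ⊂ unseen H
  improve H {w} w≢0 periodOn with nonPeriod⇒witness q (w≢0 ∘ aperiodic w)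
  ... | y , ny = H′ , (λ i∈ → ∈-unseen⁺ H (∈-unseen⁻ H′ i∈ ∘ sees-preserved))
                    , q (y ⊕ w) , ∈-unseen⁺ H unseen-before , (λ i∈ → ∈-unseen⁻ H′ i∈ seen-after)
    where
    H′ : Hyperplane
    H′ = through y ny

    sees-preserved : ∀ {i} → Sees H i → Sees H′ i
    sees-preserved (z , z∈H , refl) with through⊎shifted y ny z
    ... | inj₁ z∈H′   = z , z∈H′ , refl
    ... | inj₂ z⊕w∈H′ = z ⊕ w , z⊕w∈H′ , periodOn z z∈H

    seen-after : Sees H′ (q (y ⊕ w))
    seen-after = y ⊕ w , through-flip y ny y , refl

    unseen-before : ¬ Sees H (q (y ⊕ w))
    unseen-before (z , z∈H , qz≡qy⊕w) = ny (sym (trans qy≡qz qz≡qy⊕w))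
      where
      open ≡-Reasoning
      qy≡qz : q y ≡ q z
      qy≡qz = begin
        q y                          ≡⟨ cong q (trans (cong (w ⊕_) (⊕-comm y w)) (⊕-cancelˡ w y)) ⟨
        q (w ⊕ (y ⊕ w))              ≡⟨ cong (λ x → q (x ⊕ (y ⊕ w))) (⊕-cancelˡ z w) ⟨
        q ((z ⊕ (z ⊕ w)) ⊕ (y ⊕ w))  ≡⟨ affine z (z ⊕ w) (y ⊕ w) (periodOn z z∈H) (sym qz≡qy⊕w) ⟩
        q z                          ∎

  descend : (H : Hyperplane) → Acc _⊂_ (unseen H) → m < k
  descend H (acc smaller) with aperiodic⊎period (restrict H)
  ... | inj₁ restriction-aperiodic = restriction-bound (restrict H) (restrict-affine H) restriction-aperiodic
  ... | inj₂ (w , w≢0 , period) =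
    let H′ , H′⊂H = improve H (direction-nonzero H w≢0) (restrict-period H period)
    in descend H′ (smaller H′⊂H)

  m<k : m < k
  m<k =
    let y , ny = nonPeriod⇒witness q (λ period → contradiction (aperiodic (true ∷ 0ᵛ) period) λ ())
    in descend (through y ny) (⊂-wellFounded _)

aperiodicAffineColouring⇒n<k : ∀ n (q : Colouring n k) → IsAffineColouring q → IsAperiodic q → n < k
aperiodicAffineColouring⇒n<k {zero}  n       q _ _ with q 0ᵛ
... | ()
aperiodicAffineColouring⇒n<k {suc k} zero    q _ _ = s≤s z≤n
aperiodicAffineColouring⇒n<k {suc k} (suc n) q affine aperiodic =
  s≤s (HyperplaneDescent.m<k q affine aperiodic (aperiodicAffineColouring⇒n<k n))

theorem4p8 : (n k : ℕ) → 1 ≤ n → (A : Fin k → AffineSubspace n) →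
    IsAVSP A → IsTight A → suc n ≤ k
-- The bound holds for n = 0 as well.
theorem4p8 n k _ A avsp tight = aperiodicAffineColouring⇒n<k n part part-affine (part-aperiodic tight)
  where open PartitionColouring {A = A} avsp
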